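{- Let $(G,\chi)$ be a colored graph with $n=|V(G)|$. Then $\mathrm{WLD}_1(G,\chi)\le\frac{n-1}{2}$.
   Context: $\mathrm{WL}_1(G,\chi)(v)$ denotes the stable color of $v$ under color refinement ($1$-WL), which iteratively recolors each vertex by (old color, multiset of neighbors' old colors). $\chi[u]$ gives $u$ a new unique color. A flip function for $(G,\chi)$ is a symmetric map $f\colon\mathrm{im}(\chi)^2\to\{0,1\}$; $\mathrm{flip}_f(G,\chi)=(G',\chi)$ with $V(G')=V(G)$ and, for distinct $v,w$, $vw\in E(G')$ iff ($vw\in E(G)$ xor $f(\chi(v),\chi(w))=1$). A $1$-IRC tree of $(G,\chi)$ is a rooted tree $(T,r)$ with $\gamma$ assigning each node $t$ a colored graph $(G_t,\chi_t)$, $\gamma(r)=(G,\chi)$, every leaf has $|V(G_t)|=1$, and each internal node satisfies at least one of: (D1) one child $s$, $G_s=G_t$, $\chi_s(v)=\mathrm{WL}_1(G_t,\chi_t)(v)$; (D2) one child $s$ with $(G_s,\chi_s)=\mathrm{flip}_f(G_t,\chi_t)$ for some flip function $f$; (D3) $G_t$ has components with vertex sets $A_1,\dots,A_\ell$ and $t$ has $\ell$ children $s_i$ with $(G_{s_i},\chi_{s_i})=(G_t[A_i],\chi_t|_{A_i})$; (D4) one child $s$ with $G_s=G_t$, $\chi_s=\chi_t[u]$ for some $u$. An individualization node satisfies (D4) and none of (D1)–(D3); the individualization depth is the maximal number of individualization nodes on a root-to-leaf path; $\mathrm{WLD}_1(G,\chi)$ is the minimum individualization depth over all $1$-IRC trees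 of $(G,\chi)$. -}

module Defs where

open import Data.Nat using (ℕ; zero; suc; _≡ᵇ_)
open import Data.Bool using (Bool; true; false; _∧_; _∨_; not; _xor_; T; if_then_else_)
open import Data.Fin using (Fin)
open import Data.Fin.Properties using () renaming (_≟_ to _≟ᶠ_)
open import Data.List using (List; length; filterᵇ; map; and)
open import Data.List using () renaming (allFin to allFinL)
open import Data.Product using (Σ; _×_)
open import Relation.Nullary.Decidable using (⌊_⌋)
open import Relation.Binary.PropositionalEquality using (_≡_; _≢_)
open import Function.Bundles using (_⇔_)

-- A colored graph lives inside an ambient finite set
-- Fin N: its vertex set is the subset V (vertices v with V v = true),
-- E is the adjacency (only used for distinct vertices of V; the input
-- graph is assumed symmetric), and χ assigns colors (natural numbers)
-- to vertices.  Keeping the ambient names lets induced subgraphs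
-- G[A] be formed without re-indexing.

record ColGraph (N : ℕ) : Set where
  field
    V : Fin N → Bool
    E : Fin N → Fin N → Bool
    χ : Fin N → ℕ
open ColGraph public

module _ {N : ℕ} where

  _==ᶠ_ : Fin N → Fin N → Bool
  v ==ᶠ w = ⌊ v ≟ᶠ w ⌋

  countᵇ : (Fin N → Bool) → ℕ
  countᵇ p = length (filterᵇ p (allFinL N))

  size : ColGraph N → ℕ
  size G = countᵇ (V G)

  adj : ColGraph N → Fin N → Fin N → Bool
  adj G v w = E G v w ∧ not (v ==ᶠ w)

  -- Color refinement (1-WL).  wl G i v w = true iff v and w have the
  -- same color after i refinement rounds.
  -- Round i+1: same round-i color and the same multiset of round-i
  -- colors of neighbours (compared class by class: for every class,
  -- represented by some x ∈ V, the numbers of neighbours in that class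
  -- agree).
  mutual
    wl : ColGraph N → ℕ → Fin N → Fin N → Bool
    wl G zero    v w = χ G v ≡ᵇ χ G w
    wl G (suc i) v w =
      wl G i v w ∧ and (map (λ x → not (V G x) ∨ (nbCount G i v x ≡ᵇ nbCount G i w x)) (allFinL N))

    nbCount : ColGraph N → ℕ → Fin N → Fin N → ℕ
    nbCount G i v x = countᵇ (λ y → V G y ∧ adj G v y ∧ wl G i y x)

  -- v and w receive the same stable color WL_1(G,χ): they agree in
  -- every round (the refinement is monotone and stabilises).
  StableEq : ColGraph N → Fin N → Fin N → Set
  StableEq G v w = (i : ℕ) → T (wl G i v w)

  flip : ColGraph N → (ℕ → ℕ → Bool) → ColGraph N
  flip G f = record { V = V G ; E = λ v w → E G v w xor f (χ G v) (χ G w) ; χ = χ G }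

  -- χ[u]: u gets color c (required to be new), all else unchanged
  indiv : ColGraph N → Fin N → ℕ → ColGraph N
  indiv G u c = record { V = V G ; E = E G ; χ = λ v → if v ==ᶠ u then c else χ G v }

  recolor : ColGraph N → (Fin N → ℕ) → ColGraph N
  recolor G χ' = record { V = V G ; E = E G ; χ = χ' }

  induced : ColGraph N → (Fin N → Bool) → ColGraph N
  induced G A = record { V = A ; E = E G ; χ = χ G }

  data Reach (G : ColGraph N) (v : Fin N) : Fin N → Set where
    here : T (V G v) → Reach G v v
    step : ∀ {x w} → Reach G v x → T (V G w) → T (adj G x w) → Reach G v w

  -- HasIRC k G : (G,χ) has a 1-IRC tree of individualization depth ≤ k.
  -- Constructors correspond to the leaf condition and rules (D1)–(D4);
  -- only (D4) steps are counted.  (A node that satisfies D4 and also one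
  -- of D1–D3 can always be labelled by the latter, so the minimum over
  -- trees agrees with the paper's WLD_1.)
  data HasIRC : ℕ → ColGraph N → Set where
    leaf : ∀ {k G} → size G ≡ 1 → HasIRC k G
    -- (D1) child carries the stable 1-WL coloring (any coloring that
    --      induces exactly the stable WL partition on V)
    d1 : ∀ {k G} (χ' : Fin N → ℕ) →
         (∀ v w → T (V G v) → T (V G w) → (χ' v ≡ χ' w) ⇔ StableEq G v w) →
         HasIRC k (recolor G χ') → HasIRC k G
    d2 : ∀ {k G} (f : ℕ → ℕ → Bool) → (∀ a b → f a b ≡ f b a) →
         HasIRC k (flip G f) → HasIRC k G
    -- (D3) one child per connected component: for every vertex v, the
    --      induced subgraph on the component of v has a tree
    d3 : ∀ {k G} →
         (∀ v → T (V G v) →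
            Σ (Fin N → Bool) λ A → (∀ w → T (A w) ⇔ Reach G v w) × HasIRC k (induced G A)) →
         HasIRC k G
    d4 : ∀ {k G} (u : Fin N) (c : ℕ) → T (V G u) → (∀ v → T (V G v) → χ G v ≢ c) →
         HasIRC k (indiv G u c) → HasIRC (suc k) G

module Submission where

-- Colour refinement yields an equitable colouring; let c be its number of classes, so 1 ≤ c ≤ n.
-- If adjacency between any two colour classes, and inside any class, is all-or-nothing, one flip
-- makes the graph edgeless, and its components are single vertices.  Otherwise there are u ~ v
-- and u′ ≁ v′ (u′ ≠ v′) with χ u = χ u′ and χ v = χ v′, and equitability gives u a non-neighbour
-- w ≠ u in the class of v.  Individualising u and refining again isolates u and separates v from
-- w; this splits one class into three pieces or two classes into two pieces each, so c grows by
-- at least 2.  Hence n ≤ 2k + 1 + c suffices for individualisation depth k, and k = ⌊(n − 1)/2⌋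
-- satisfies it because c ≥ 1.

open import Defs
open import Data.Bool using (Bool; true; false; T; not; _∧_; _∨_; _xor_)
open import Data.Bool.Properties using (T-∧)
open import Data.Fin using (Fin; zero; suc; toℕ; _≟_)
import Data.Fin as Fin
open import Data.Fin.Induction using (<-wellFounded)
open import Data.Fin.Properties using (all?; any?; toℕ-injective; toℕ<n; <-cmp; suc-injective; 0≢1+n)
open import Data.List using (allFin; length; filter; tabulate)
open import Data.List.Membership.Propositional.Properties using (∈-allFin)
open import Data.List.Relation.Unary.All as All using ()
open import Data.List.Relation.Unary.All.Properties using (all⁺; all⁻)
open import Data.Nat using (ℕ; zero; suc; _+_; _*_; _≤_; _<_; z≤n; s≤s)
import Data.Nat as ℕ
open import Data.Nat.Properties
  using ( ≤-refl; ≤-trans; ≤-antisym; ≤-<-trans; <⇒≱; <⇒≢; 1+n≰n; m≤n⇒m≤1+n; m≤m+n; m<m+n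
        ; +-comm; +-suc; *-suc; +-mono-≤; +-monoʳ-≤; +-cancelˡ-≡; ≡ᵇ⇒≡; ≡⇒≡ᵇ; ≡-isDecEquivalence
        ; module ≤-Reasoning )
open import Data.Nat.Solver using (module +-*-Solver)
open import Data.Product using (_×_; _,_; ∃; ∃-syntax; proj₁; proj₂)
open import Data.Sum using (_⊎_; inj₁; inj₂)
open import Function using (_∘_; _on_; id)
open import Function.Bundles using (_⇔_; mk⇔; module Equivalence)
open Equivalence using (to; from)
open import Induction.WellFounded using (Acc; acc)
open import Level using (Level; 0ℓ)
open import Relation.Binary using (Rel; IsDecEquivalence; tri<; tri≈; tri>)
import Relation.Binary.Construct.On as On
open import Relation.Binary.PropositionalEquality
open import Relation.Nullary using (¬_; Dec; does; yes; no; contradiction; ¬?)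
open import Relation.Nullary.Decidable
  using (T?; _×-dec_; _→-dec_; decidable-stable; does-⇔; dec-true; dec-false
        ; toWitness; fromWitness; toWitnessFalse; fromWitnessFalse)
open import Relation.Unary using (Pred; Decidable; _⊆_; _≐_; _∩_; ∁)
open import Relation.Unary.Properties using (_∩?_; ∁?)

private
  variable
    ℓ ℓ′ : Level
    n N : ℕ

-- Counting

count : {P : Pred (Fin n) ℓ} → Decidable P → ℕ
count {n = zero} P? = 0
count {n = suc n} P? with P? zero
... | yes _ = suc (count (P? ∘ suc))
... | no _ = count (P? ∘ suc)

length-filter-tabulate : ∀ {a} {A : Set a} {P : Pred A ℓ} (P? : Decidable P) (f : Fin n → A) →
                         length (filter P? (tabulate f)) ≡ count (P? ∘ f)
length-filter-tabulate {n = zero} P? f = refl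
length-filter-tabulate {n = suc n} P? f with P? (f zero)
... | yes _ = cong suc (length-filter-tabulate P? (f ∘ suc))
... | no _ = length-filter-tabulate P? (f ∘ suc)

count-mono : {P : Pred (Fin n) ℓ} {Q : Pred (Fin n) ℓ′} (P? : Decidable P) (Q? : Decidable Q) →
             P ⊆ Q → count P? ≤ count Q?
count-mono {n = zero} P? Q? P⊆Q = z≤n
count-mono {n = suc n} P? Q? P⊆Q with P? zero | Q? zero
... | yes p | yes _ = s≤s (count-mono (P? ∘ suc) (Q? ∘ suc) P⊆Q)
... | yes p | no ¬q = contradiction (P⊆Q p) ¬q
... | no _ | yes _ = m≤n⇒m≤1+n (count-mono (P? ∘ suc) (Q? ∘ suc) P⊆Q)
... | no _ | no _ = count-mono (P? ∘ suc) (Q? ∘ suc) P⊆Q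

count-cong : {P : Pred (Fin n) ℓ} {Q : Pred (Fin n) ℓ′} (P? : Decidable P) (Q? : Decidable Q) →
             P ≐ Q → count P? ≡ count Q?
count-cong P? Q? (P⊆Q , Q⊆P) = ≤-antisym (count-mono P? Q? P⊆Q) (count-mono Q? P? Q⊆P)

count-split : {P : Pred (Fin n) ℓ} {Q : Pred (Fin n) ℓ′} (P? : Decidable P) (Q? : Decidable Q) →
              count P? ≡ count (P? ∩? Q?) + count (P? ∩? ∁? Q?)
count-split {n = zero} P? Q? = refl
count-split {n = suc n} P? Q? with P? zero | Q? zero
... | yes _ | yes _ = cong suc (count-split (P? ∘ suc) (Q? ∘ suc))
... | yes _ | no _ = trans (cong suc (count-split (P? ∘ suc) (Q? ∘ suc))) (sym (+-suc _ _))
... | no _ | _ = count-split (P? ∘ suc) (Q? ∘ suc)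

count-pos : {P : Pred (Fin n) ℓ} (P? : Decidable P) {x : Fin n} → P x → 0 < count P?
count-pos {n = suc n} P? {x} px with P? zero | x
... | yes _ | _ = s≤s z≤n
... | no ¬p0 | zero = contradiction px ¬p0
... | no _ | suc x = count-pos (P? ∘ suc) px

count-witness : {P : Pred (Fin n) ℓ} (P? : Decidable P) → 0 < count P? → ∃ P
count-witness {n = suc n} P? pos with P? zero
... | yes p0 = zero , p0
... | no _ = let x , px = count-witness (P? ∘ suc) pos in suc x , px

count-none : {P : Pred (Fin n) ℓ} (P? : Decidable P) → (∀ x → ¬ P x) → count P? ≡ 0
count-none {n = zero} P? none = refl
count-none {n = suc n} P? none with P? zero
... | yes p0 = contradiction p0 (none zero)
... | no _ = count-none (P? ∘ suc) (none ∘ suc)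

count-single : {P : Pred (Fin n) ℓ} (P? : Decidable P) {x : Fin n} →
               P x → (∀ {y} → P y → y ≡ x) → count P? ≡ 1
count-single {n = suc n} P? {zero} px unique with P? zero
... | yes _ = cong suc (count-none (P? ∘ suc) (λ y py → 0≢1+n (sym (unique py))))
... | no ¬p0 = contradiction px ¬p0
count-single {n = suc n} P? {suc x} px unique with P? zero
... | yes p0 = contradiction (unique p0) 0≢1+n
... | no _ = count-single (P? ∘ suc) px (suc-injective ∘ unique)

count-two : {P : Pred (Fin n) ℓ} (P? : Decidable P) {x y : Fin n} →
            P x → P y → x ≢ y → 2 ≤ count P?
count-two P? {x} {y} px py x≢y = begin
  2                                               ≤⟨ +-mono-≤ (count-pos (P? ∩? (_≟ x)) (px , refl))
                                                               (count-pos (P? ∩? ∁? (_≟ x)) (py , x≢y ∘ sym)) ⟩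
  count (P? ∩? (_≟ x)) + count (P? ∩? ∁? (_≟ x))  ≡⟨ count-split P? (_≟ x) ⟨
  count P?                                        ∎
  where open ≤-Reasoning

count-at-cong : {P : Pred (Fin n) ℓ} (P? : Decidable P) {x x′ : Fin n} →
                P x ⇔ P x′ → count (P? ∩? (_≟ x)) ≡ count (P? ∩? (_≟ x′))
count-at-cong P? {x} {x′} Px⇔Px′ with P? x | P? x′
... | yes px | yes px′ = trans (count-single (P? ∩? (_≟ x)) (px , refl) proj₂)
                               (sym (count-single (P? ∩? (_≟ x′)) (px′ , refl) proj₂))
... | no ¬px | no ¬px′ = trans (count-none (P? ∩? (_≟ x)) λ { _ (py , refl) → ¬px py })
                               (sym (count-none (P? ∩? (_≟ x′)) λ { _ (py , refl) → ¬px′ py }))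
... | yes px | no ¬px′ = contradiction (to Px⇔Px′ px) ¬px′
... | no ¬px | yes px′ = contradiction (from Px⇔Px′ px′) ¬px

count-remove-cong : {P : Pred (Fin n) ℓ} (P? : Decidable P) {x x′ : Fin n} →
                    P x ⇔ P x′ → count (P? ∩? ∁? (_≟ x)) ≡ count (P? ∩? ∁? (_≟ x′))
count-remove-cong P? {x} {x′} Px⇔Px′ = +-cancelˡ-≡ (count (P? ∩? (_≟ x))) _ _ (begin
  count (P? ∩? (_≟ x)) + count (P? ∩? ∁? (_≟ x))    ≡⟨ count-split P? (_≟ x) ⟨
  count P?                                          ≡⟨ count-split P? (_≟ x′) ⟩
  count (P? ∩? (_≟ x′)) + count (P? ∩? ∁? (_≟ x′))  ≡⟨ cong (_+ _) (count-at-cong P? Px⇔Px′) ⟨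
  count (P? ∩? (_≟ x)) + count (P? ∩? ∁? (_≟ x′))   ∎)
  where open ≡-Reasoning

countᵇ≡count : {P : Pred (Fin N) ℓ} (p : Fin N → Bool) (P? : Decidable P) →
               (∀ {x} → T (p x) → P x) → (∀ {x} → P x → T (p x)) → countᵇ p ≡ count P?
countᵇ≡count p P? sound complete =
  trans (length-filter-tabulate (T? ∘ p) id) (count-cong (T? ∘ p) P? (sound , complete))

-- Partitions of a finite vertex set

module _ {N : ℕ} (V : Fin N → Bool) where

  module _ {_≈_ : Rel (Fin N) 0ℓ} (isDecEq : IsDecEquivalence _≈_) where
    open IsDecEquivalence isDecEq using () renaming (_≟_ to _≈?_; refl to ≈-refl; sym to ≈-sym; trans to ≈-trans)

    IsLeader : Pred (Fin N) 0ℓ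
    IsLeader v = T (V v) × (∀ w → w Fin.< v → T (V w) → ¬ w ≈ v)

    isLeader? : Decidable IsLeader
    isLeader? v = T? (V v) ×-dec all? (λ w → w Fin.<? v →-dec T? (V w) →-dec ¬? (w ≈? v))

    classCount : ℕ
    classCount = count isLeader?

    leader-unique : ∀ {z z′} → IsLeader z → IsLeader z′ → z ≈ z′ → z ≡ z′
    leader-unique {z} {z′} (z∈V , z-first) (z′∈V , z′-first) z≈z′ with <-cmp z z′
    ... | tri< z<z′ _ _ = contradiction z≈z′ (z′-first z z<z′ z∈V)
    ... | tri≈ _ z≡z′ _ = z≡z′
    ... | tri> _ _ z′<z = contradiction (≈-sym z≈z′) (z-first z′ z′<z z′∈V)

    leader-exists : ∀ {v} → T (V v) → ∃[ z ] (IsLeader z × z ≈ v)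
    leader-exists {v} = go v (<-wellFounded v)
      where
      go : ∀ v → Acc Fin._<_ v → T (V v) → ∃[ z ] (IsLeader z × z ≈ v)
      go v (acc earlier) v∈V with any? (λ w → w Fin.<? v ×-dec T? (V w) ×-dec w ≈? v)
      ... | no none = v , (v∈V , λ w w<v w∈V w≈v → none (w , w<v , w∈V , w≈v)) , ≈-refl
      ... | yes (w , w<v , w∈V , w≈v) =
        let z , z-leader , z≈w = go w (earlier w<v) w∈V in z , z-leader , ≈-trans z≈w w≈v

    classCount≤size : classCount ≤ count (T? ∘ V)
    classCount≤size = count-mono isLeader? (T? ∘ V) proj₁

    classCount-pos : ∀ {v} → T (V v) → 0 < classCount
    classCount-pos v∈V = let z , z-leader , _ = leader-exists v∈V in count-pos isLeader? z-leader

    -- 0 is a junk value for v outside V.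
    classIndex : Fin N → ℕ
    classIndex v with T? (V v)
    ... | yes v∈V = toℕ (proj₁ (leader-exists v∈V))
    ... | no _ = 0

    classIndex-leader : ∀ {v z} → T (V v) → IsLeader z → z ≈ v → classIndex v ≡ toℕ z
    classIndex-leader {v} v∈V z-leader z≈v with T? (V v)
    ... | no v∉V = contradiction v∈V v∉V
    ... | yes v∈V′ = let z′ , z′-leader , z′≈v = leader-exists v∈V′ in
      cong toℕ (leader-unique z′-leader z-leader (≈-trans z′≈v (≈-sym z≈v)))

    classIndex-≡⇔ : ∀ {v w} → T (V v) → T (V w) → classIndex v ≡ classIndex w ⇔ v ≈ w
    classIndex-≡⇔ {v} {w} v∈V w∈V
      with zv , zv-leader , zv≈v ← leader-exists v∈V
         | zw , zw-leader , zw≈w ← leader-exists w∈V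
      = mk⇔ (λ eq → ≈-trans (≈-sym zv≈v) (subst (_≈ w) (sym (toℕ-injective (trans (sym iv) (trans eq iw)))) zw≈w))
            (λ v≈w → trans iv (trans (cong toℕ (leader-unique zv-leader zw-leader
                                                  (≈-trans zv≈v (≈-trans v≈w (≈-sym zw≈w)))))
                                     (sym iw)))
      where
      iv : classIndex v ≡ toℕ zv
      iv = classIndex-leader v∈V zv-leader zv≈v
      iw : classIndex w ≡ toℕ zw
      iw = classIndex-leader w∈V zw-leader zw≈w

    classIndex<N : ∀ {v} → T (V v) → classIndex v < N
    classIndex<N v∈V with z , z-leader , z≈v ← leader-exists v∈V
      rewrite classIndex-leader v∈V z-leader z≈v = toℕ<n z

  module Refinement {_≈_ _≈′_ : Rel (Fin N) 0ℓ}
                    (isDecEq : IsDecEquivalence _≈_) (isDecEq′ : IsDecEquivalence _≈′_)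
                    (refines : ∀ {v w} → T (V v) → T (V w) → v ≈′ w → v ≈ w) where
    open IsDecEquivalence isDecEq using () renaming (sym to ≈-sym; trans to ≈-trans)
    open IsDecEquivalence isDecEq′ using () renaming (_≟_ to _≈′?_; sym to ≈′-sym; trans to ≈′-trans)

    NewLeader : Pred (Fin N) 0ℓ
    NewLeader = IsLeader isDecEq′ ∩ ∁ (IsLeader isDecEq)

    newLeader? : Decidable NewLeader
    newLeader? = isLeader? isDecEq′ ∩? ∁? (isLeader? isDecEq)

    newLeader∈V : ∀ {z} → NewLeader z → T (V z)
    newLeader∈V ((z∈V , _) , _) = z∈V

    leader-refines : ∀ {z} → IsLeader isDecEq z → IsLeader isDecEq′ z
    leader-refines (z∈V , z-first) = z∈V , λ w w<z w∈V w≈′z → z-first w w<z w∈V (refines w∈V z∈V w≈′z)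

    classCount-refine : classCount isDecEq′ ≡ classCount isDecEq + count newLeader?
    classCount-refine = trans (count-split (isLeader? isDecEq′) (isLeader? isDecEq))
      (cong (_+ count newLeader?)
            (count-cong (isLeader? isDecEq′ ∩? isLeader? isDecEq) (isLeader? isDecEq)
                        (proj₂ , λ z-leader → leader-refines z-leader , z-leader)))

    newLeader⇒classCount< : ∀ {z} → NewLeader z → classCount isDecEq < classCount isDecEq′
    newLeader⇒classCount< new = subst (classCount isDecEq <_) (sym classCount-refine)
                                      (m<m+n (classCount isDecEq) (count-pos newLeader? new))

    newLeaders⇒classCount+2≤ : ∀ {z₁ z₂} → NewLeader z₁ → NewLeader z₂ → z₁ ≢ z₂ →
                               classCount isDecEq + 2 ≤ classCount isDecEq′
    newLeaders⇒classCount+2≤ new₁ new₂ z₁≢z₂ =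
      subst (classCount isDecEq + 2 ≤_) (sym classCount-refine)
            (+-monoʳ-≤ (classCount isDecEq) (count-two newLeader? new₁ new₂ z₁≢z₂))

    -- The new leader of x is not an old leader: it would be equivalent to, hence equal to, f.
    split-from-leader⇒newLeader : ∀ {x f} → T (V x) → IsLeader isDecEq f → x ≈ f → ¬ x ≈′ f →
                                  ∃[ z ] (NewLeader z × z ≈′ x)
    split-from-leader⇒newLeader {x} {f} x∈V f-leader x≈f x≉′f
      with z , z-leader′ , z≈′x ← leader-exists isDecEq′ x∈V
      = z , (z-leader′ , λ z-leader → x≉′f (subst (x ≈′_) (z≡f z-leader) (≈′-sym z≈′x))) , z≈′x
      where
      z≡f : IsLeader isDecEq z → z ≡ f
      z≡f z-leader =
        leader-unique isDecEq z-leader f-leader (≈-trans (refines (proj₁ z-leader′) x∈V z≈′x) x≈f)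

    split⇒newLeader : ∀ {a b} → T (V a) → T (V b) → a ≈ b → ¬ a ≈′ b → ∃[ z ] (NewLeader z × z ≈ a)
    split⇒newLeader {a} {b} a∈V b∈V a≈b a≉′b
      with f , f-leader , f≈a ← leader-exists isDecEq a∈V | a ≈′? f
    ... | yes a≈′f =
      let z , new , z≈′b = split-from-leader⇒newLeader b∈V f-leader (≈-sym (≈-trans f≈a a≈b))
                             (λ b≈′f → a≉′b (≈′-trans a≈′f (≈′-sym b≈′f)))
      in z , new , ≈-trans (refines (newLeader∈V new) b∈V z≈′b) (≈-sym a≈b)
    ... | no a≉′f =
      let z , new , z≈′a = split-from-leader⇒newLeader a∈V f-leader (≈-sym f≈a) a≉′f
      in z , new , refines (newLeader∈V new) a∈V z≈′a

    split⇒classCount< : ∀ {a b} → T (V a) → T (V b) → a ≈ b → ¬ a ≈′ b →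
                        classCount isDecEq < classCount isDecEq′
    split⇒classCount< a∈V b∈V a≈b a≉′b =
      newLeader⇒classCount< (proj₁ (proj₂ (split⇒newLeader a∈V b∈V a≈b a≉′b)))

    split₂⇒classCount+2≤ : ∀ {a b c d} → T (V a) → T (V b) → T (V c) → T (V d) →
                            a ≈ b → ¬ a ≈′ b → c ≈ d → ¬ c ≈′ d → ¬ a ≈ c →
                            classCount isDecEq + 2 ≤ classCount isDecEq′
    split₂⇒classCount+2≤ a∈V b∈V c∈V d∈V a≈b a≉′b c≈d c≉′d a≉c
      with z₁ , new₁ , z₁≈a ← split⇒newLeader a∈V b∈V a≈b a≉′b
         | z₂ , new₂ , z₂≈c ← split⇒newLeader c∈V d∈V c≈d c≉′d
      = newLeaders⇒classCount+2≤ new₁ new₂ λ { refl → a≉c (≈-trans (≈-sym z₁≈a) z₂≈c) }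

    split-from-leader₂⇒classCount+2≤ : ∀ {x y f} → T (V x) → T (V y) → IsLeader isDecEq f →
                                        x ≈ f → y ≈ f → ¬ x ≈′ f → ¬ y ≈′ f → ¬ x ≈′ y →
                                        classCount isDecEq + 2 ≤ classCount isDecEq′
    split-from-leader₂⇒classCount+2≤ x∈V y∈V f-leader x≈f y≈f x≉′f y≉′f x≉′y
      with z₁ , new₁ , z₁≈′x ← split-from-leader⇒newLeader x∈V f-leader x≈f x≉′f
         | z₂ , new₂ , z₂≈′y ← split-from-leader⇒newLeader y∈V f-leader y≈f y≉′f
      = newLeaders⇒classCount+2≤ new₁ new₂ λ { refl → x≉′y (≈′-trans (≈′-sym z₁≈′x) z₂≈′y) }

    -- At most one of a, b, c is ≈′ to the leader f of their class; the other two are split from it.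
    split₃⇒classCount+2≤ : ∀ {a b c} → T (V a) → T (V b) → T (V c) → a ≈ b → a ≈ c →
                            ¬ a ≈′ b → ¬ a ≈′ c → ¬ b ≈′ c →
                            classCount isDecEq + 2 ≤ classCount isDecEq′
    split₃⇒classCount+2≤ {a} {b} {c} a∈V b∈V c∈V a≈b a≈c a≉′b a≉′c b≉′c
      with f , f-leader , f≈a ← leader-exists isDecEq a∈V | a ≈′? f | b ≈′? f
    ... | yes a≈′f | _ =
      split-from-leader₂⇒classCount+2≤ b∈V c∈V f-leader (≈-sym (≈-trans f≈a a≈b)) (≈-sym (≈-trans f≈a a≈c))
        (λ b≈′f → a≉′b (≈′-trans a≈′f (≈′-sym b≈′f)))
        (λ c≈′f → a≉′c (≈′-trans a≈′f (≈′-sym c≈′f))) b≉′c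
    ... | no a≉′f | yes b≈′f =
      split-from-leader₂⇒classCount+2≤ a∈V c∈V f-leader (≈-sym f≈a) (≈-sym (≈-trans f≈a a≈c))
        a≉′f (λ c≈′f → b≉′c (≈′-trans b≈′f (≈′-sym c≈′f))) a≉′c
    ... | no a≉′f | no b≉′f =
      split-from-leader₂⇒classCount+2≤ a∈V b∈V f-leader (≈-sym f≈a) (≈-sym (≈-trans f≈a a≈b))
        a≉′f b≉′f a≉′b

  -- Each strict refinement step adds a class, and there are at most |V| classes.
  descending-stabilises : (R : ℕ → Rel (Fin N) 0ℓ) (isDecEq : ∀ i → IsDecEquivalence (R i)) →
                          (∀ {i v w} → T (V v) → T (V w) → R (suc i) v w → R i v w) →
                          ∃[ s ] (∀ {v w} → T (V v) → T (V w) → R s v w → R (suc s) v w)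
  descending-stabilises R isDecEq descending = go (count (T? ∘ V)) 0 (m≤m+n _ _)
    where
    Stable : ℕ → Set
    Stable i = ∀ {v w} → T (V v) → T (V w) → R i v w → R (suc i) v w

    _≟[_]_ : ∀ v i w → Dec (R i v w)
    v ≟[ i ] w = IsDecEquivalence._≟_ (isDecEq i) v w

    stable-or-finer : ∀ i → Stable i ⊎ classCount (isDecEq i) < classCount (isDecEq (suc i))
    stable-or-finer i
      with any? (λ v → any? λ w → T? (V v) ×-dec T? (V w) ×-dec v ≟[ i ] w ×-dec ¬? (v ≟[ suc i ] w))
    ... | yes (v , w , v∈V , w∈V , vRw , v≉w) =
      inj₂ (Refinement.split⇒classCount< (isDecEq i) (isDecEq (suc i)) descending v∈V w∈V vRw v≉w)
    ... | no none = inj₁ λ {v} {w} v∈V w∈V vRw →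
      decidable-stable (v ≟[ suc i ] w) λ v≉w → none (v , w , v∈V , w∈V , vRw , v≉w)

    go : ∀ m i → count (T? ∘ V) ≤ m + classCount (isDecEq i) → ∃ Stable
    go m i bound with stable-or-finer i | m
    ... | inj₁ stable | _ = i , stable
    ... | inj₂ finer | zero = contradiction (classCount≤size (isDecEq (suc i))) (<⇒≱ (≤-<-trans bound finer))
    ... | inj₂ finer | suc m =
      go m (suc i) (≤-trans bound (subst (_≤ m + classCount (isDecEq (suc i))) (+-suc m _) (+-monoʳ-≤ m finer)))

colourEquivalence : (c : Fin N → ℕ) → IsDecEquivalence (_≡_ on c)
colourEquivalence c = On.isDecEquivalence c ≡-isDecEquivalence

Undirected : ColGraph N → Set
Undirected G = ∀ v w → E G v w ≡ E G w v

colourCount : ColGraph N → (Fin N → ℕ) → ℕ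
colourCount G c = classCount (V G) (colourEquivalence c)

module _ (G : ColGraph N) where

  adj⇔ : ∀ {x y} → T (adj G x y) ⇔ (T (E G x y) × x ≢ y)
  adj⇔ {x} {y} = mk⇔ (λ xy → let e , x≢y = to (T-∧ {E G x y}) xy in e , toWitnessFalse x≢y)
                     (λ (e , x≢y) → from (T-∧ {E G x y}) (e , fromWitnessFalse x≢y))

  adj⇒≢ : ∀ {x y} → T (adj G x y) → x ≢ y
  adj⇒≢ = proj₂ ∘ to adj⇔

  adj-sym : Undirected G → ∀ {x y} → T (adj G x y) → T (adj G y x)
  adj-sym undirected {x} {y} xy = let e , x≢y = to adj⇔ xy in
    from adj⇔ (subst T (undirected x y) e , x≢y ∘ sym)

  size≡count : size G ≡ count (T? ∘ V G)
  size≡count = countᵇ≡count (V G) (T? ∘ V G) id id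

  colourCount≤size : ∀ c → colourCount G c ≤ size G
  colourCount≤size c = subst (colourCount G c ≤_) (sym size≡count) (classCount≤size (V G) (colourEquivalence c))

  colourCount-pos : ∀ c → 0 < size G → 0 < colourCount G c
  colourCount-pos c nonempty =
    classCount-pos (V G) (colourEquivalence c) (proj₂ (count-witness (T? ∘ V G) (subst (0 <_) size≡count nonempty)))

-- Equitable colourings

colourNeighbour? : (G : ColGraph N) (c : Fin N → ℕ) (x : Fin N) (k : ℕ) →
                   Decidable (λ y → T (V G y) × T (adj G x y) × c y ≡ k)
colourNeighbour? G c x k y = T? (V G y) ×-dec T? (adj G x y) ×-dec c y ℕ.≟ k

classDegree : ColGraph N → (Fin N → ℕ) → Fin N → ℕ → ℕ
classDegree G c x k = count (colourNeighbour? G c x k)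

Equitable : ColGraph N → (Fin N → ℕ) → Set
Equitable G c = ∀ {x x′ z} → T (V G x) → T (V G x′) → T (V G z) → c x ≡ c x′ →
                classDegree G c x (c z) ≡ classDegree G c x′ (c z)

module _ {G : ColGraph N} {c : Fin N → ℕ} (equitable : Equitable G c) where

  neighbour-transfer : ∀ {x x′ y} → T (V G x) → T (V G x′) → T (V G y) → c x ≡ c x′ → T (adj G x y) →
                       ∃[ y′ ] (T (V G y′) × T (adj G x′ y′) × c y′ ≡ c y)
  neighbour-transfer {x} {x′} {y} x∈V x′∈V y∈V cx≡cx′ xy =
    count-witness (colourNeighbour? G c x′ (c y))
      (subst (0 <_) (equitable x∈V x′∈V y∈V cx≡cx′)
             (count-pos (colourNeighbour? G c x (c y)) (y∈V , xy , refl)))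

  isolated-adjacency : ∀ {u a b} → T (V G u) → (∀ {y} → T (V G y) → c y ≡ c u → y ≡ u) →
                       T (V G a) → T (V G b) → c a ≡ c b → T (adj G a u) → T (adj G b u)
  isolated-adjacency u∈V isolated a∈V b∈V ca≡cb au =
    let y , y∈V , by , cy≡cu = neighbour-transfer a∈V b∈V u∈V ca≡cb au
    in subst (T ∘ adj G _) (isolated y∈V cy≡cu) by

  -- x and x′ have equally many neighbours in the class of y′, and that class has equally many
  -- elements besides x as besides x′; so they also have equally many non-neighbours besides themselves.
  nonNeighbour-transfer : ∀ {x x′ y′} → T (V G x) → T (V G x′) → T (V G y′) → c x ≡ c x′ →
                          y′ ≢ x′ → ¬ T (adj G x′ y′) →
                          ∃[ y ] (T (V G y) × c y ≡ c y′ × y ≢ x × ¬ T (adj G x y))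
  nonNeighbour-transfer {x} {x′} {y′} x∈V x′∈V y′∈V cx≡cx′ y′≢x′ ¬x′y′ =
    let y , ((y∈V , cy≡k) , y≢x) , ¬xy = count-witness (others x ∩? ∁? (adjacent? x)) positive
    in y , y∈V , cy≡k , y≢x , ¬xy
    where
    open ≡-Reasoning
    k = c y′
    inClass? : Decidable (λ y → T (V G y) × c y ≡ k)
    inClass? y = T? (V G y) ×-dec c y ℕ.≟ k
    others : (z : Fin N) → Decidable (λ y → (T (V G y) × c y ≡ k) × y ≢ z)
    others z = inClass? ∩? ∁? (_≟ z)
    adjacent? : (z : Fin N) → Decidable (T ∘ adj G z)
    adjacent? z y = T? (adj G z y)
    nonNeighbours : Fin N → ℕ
    nonNeighbours z = count (others z ∩? ∁? (adjacent? z))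
    others-split : ∀ z → count (others z) ≡ classDegree G c z k + nonNeighbours z
    others-split z = trans (count-split (others z) (adjacent? z))
      (cong (_+ nonNeighbours z) (count-cong (others z ∩? adjacent? z) (colourNeighbour? G c z k)
        ( (λ (((y∈V , cy≡k) , _) , zy) → y∈V , zy , cy≡k)
        , (λ (y∈V , zy , cy≡k) → ((y∈V , cy≡k) , adj⇒≢ G zy ∘ sym) , zy))))
    same-class : (T (V G x) × c x ≡ k) ⇔ (T (V G x′) × c x′ ≡ k)
    same-class = mk⇔ (λ (_ , cx≡k) → x′∈V , trans (sym cx≡cx′) cx≡k)
                     (λ (_ , cx′≡k) → x∈V , trans cx≡cx′ cx′≡k)
    same : nonNeighbours x ≡ nonNeighbours x′
    same = +-cancelˡ-≡ (classDegree G c x k) _ _ (begin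
      classDegree G c x k + nonNeighbours x    ≡⟨ others-split x ⟨
      count (others x)                         ≡⟨ count-remove-cong inClass? same-class ⟩
      count (others x′)                        ≡⟨ others-split x′ ⟩
      classDegree G c x′ k + nonNeighbours x′  ≡⟨ cong (_+ nonNeighbours x′) (equitable x∈V x′∈V y′∈V cx≡cx′) ⟨
      classDegree G c x k + nonNeighbours x′   ∎)
    positive : 0 < nonNeighbours x
    positive = subst (0 <_) (sym same)
                     (count-pos (others x′ ∩? ∁? (adjacent? x′)) (((y′∈V , refl) , y′≢x′) , ¬x′y′))

-- Colour refinement

T-∧₃ : ∀ {a b c} → T (a ∧ b ∧ c) ⇔ (T a × T b × T c)
T-∧₃ {true} {true} {true} = mk⇔ (λ _ → _ , _ , _) (λ _ → _)
T-∧₃ {true} {true} {false} = mk⇔ (λ ()) (λ ())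
T-∧₃ {true} {false} = mk⇔ (λ ()) (λ ())
T-∧₃ {false} = mk⇔ (λ ()) (λ ())

T-implies : ∀ {a b} → T (not a ∨ b) ⇔ (T a → T b)
T-implies {true} = mk⇔ (λ b _ → b) (λ f → f _)
T-implies {false} = mk⇔ (λ _ ()) (λ _ → _)

module _ (G : ColGraph N) where

  WL : ℕ → Rel (Fin N) 0ℓ
  WL i v w = T (wl G i v w)

  wl-zero⇔ : ∀ {v w} → WL 0 v w ⇔ χ G v ≡ χ G w
  wl-zero⇔ {v} {w} = mk⇔ (≡ᵇ⇒≡ (χ G v) (χ G w)) (≡⇒≡ᵇ (χ G v) (χ G w))

  wl-suc⇔ : ∀ i {v w} → WL (suc i) v w ⇔ (WL i v w × (∀ x → T (V G x) → nbCount G i v x ≡ nbCount G i w x))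
  wl-suc⇔ i {v} {w} = mk⇔
    (λ v∼w → let previous , agreeing = to (T-∧ {wl G i v w}) v∼w in
      previous , λ x x∈V →
        ≡ᵇ⇒≡ _ _ (to T-implies (All.lookup (all⁺ agrees (allFin N) agreeing) (∈-allFin x)) x∈V))
    (λ (previous , same) → from (T-∧ {wl G i v w}) (previous ,
      all⁻ agrees {xs = allFin N} (All.tabulate λ {x} _ → from T-implies (≡⇒≡ᵇ _ _ ∘ same x))))
    where
    agrees : Fin N → Bool
    agrees x = not (V G x) ∨ (nbCount G i v x ℕ.≡ᵇ nbCount G i w x)

  wl-refl : ∀ i {v} → WL i v v
  wl-refl zero = from wl-zero⇔ refl
  wl-refl (suc i) = from (wl-suc⇔ i) (wl-refl i , λ _ _ → refl)

  wl-sym : ∀ i {v w} → WL i v w → WL i w v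
  wl-sym zero v∼w = from wl-zero⇔ (sym (to wl-zero⇔ v∼w))
  wl-sym (suc i) v∼w = let previous , same = to (wl-suc⇔ i) v∼w in
    from (wl-suc⇔ i) (wl-sym i previous , λ x x∈V → sym (same x x∈V))

  wl-trans : ∀ i {u v w} → WL i u v → WL i v w → WL i u w
  wl-trans zero u∼v v∼w = from wl-zero⇔ (trans (to wl-zero⇔ u∼v) (to wl-zero⇔ v∼w))
  wl-trans (suc i) u∼v v∼w =
    let previous₁ , same₁ = to (wl-suc⇔ i) u∼v
        previous₂ , same₂ = to (wl-suc⇔ i) v∼w
    in from (wl-suc⇔ i) (wl-trans i previous₁ previous₂ , λ x x∈V → trans (same₁ x x∈V) (same₂ x x∈V))

  wl-isDecEquivalence : ∀ i → IsDecEquivalence (WL i)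
  wl-isDecEquivalence i = record
    { isEquivalence = record { refl = wl-refl i ; sym = wl-sym i ; trans = wl-trans i }
    ; _≟_ = λ v w → T? (wl G i v w)
    }

  wl-descending : ∀ i {v w} → WL (suc i) v w → WL i v w
  wl-descending i = proj₁ ∘ to (wl-suc⇔ i)

  wlNeighbour? : ∀ i v x → Decidable (λ y → T (V G y) × T (adj G v y) × WL i y x)
  wlNeighbour? i v x y = T? (V G y) ×-dec T? (adj G v y) ×-dec T? (wl G i y x)

  nbCount≡count : ∀ i v x → nbCount G i v x ≡ count (wlNeighbour? i v x)
  nbCount≡count i v x = countᵇ≡count (λ y → V G y ∧ adj G v y ∧ wl G i y x) (wlNeighbour? i v x)
                                     (to T-∧₃) (from T-∧₃)

  StableRound : ℕ → Set
  StableRound s = ∀ {v w} → T (V G v) → T (V G w) → WL s v w → WL (suc s) v w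

  nbCount-stable : ∀ s {v x} → StableRound s → T (V G x) → nbCount G (suc s) v x ≡ nbCount G s v x
  nbCount-stable s {v} {x} stable x∈V = begin
    nbCount G (suc s) v x              ≡⟨ nbCount≡count (suc s) v x ⟩
    count (wlNeighbour? (suc s) v x)   ≡⟨ count-cong (wlNeighbour? (suc s) v x) (wlNeighbour? s v x)
                                            ( (λ (y∈V , vy , y∼x) → y∈V , vy , wl-descending s y∼x)
                                            , (λ (y∈V , vy , y∼x) → y∈V , vy , stable y∈V x∈V y∼x)) ⟩
    count (wlNeighbour? s v x)         ≡⟨ nbCount≡count s v x ⟨
    nbCount G s v x                    ∎
    where open ≡-Reasoning

  stableRound-suc : ∀ s → StableRound s → StableRound (suc s)
  stableRound-suc s stable {v} {w} v∈V w∈V v∼w = from (wl-suc⇔ (suc s)) (v∼w , λ x x∈V → begin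
    nbCount G (suc s) v x  ≡⟨ nbCount-stable s stable x∈V ⟩
    nbCount G s v x        ≡⟨ proj₂ (to (wl-suc⇔ s) v∼w) x x∈V ⟩
    nbCount G s w x        ≡⟨ nbCount-stable s stable x∈V ⟨
    nbCount G (suc s) w x  ∎)
    where open ≡-Reasoning

  stableRound-+ : ∀ s → StableRound s → ∀ d → StableRound (d + s)
  stableRound-+ s stable zero = stable
  stableRound-+ s stable (suc d) = stableRound-suc (d + s) (stableRound-+ s stable d)

  stableRound⇒StableEq : ∀ s → StableRound s → ∀ {v w} → T (V G v) → T (V G w) → WL s v w → StableEq G v w
  stableRound⇒StableEq s stable {v} {w} v∈V w∈V v∼w i =
    descend s (subst (λ j → WL j v w) (+-comm i s) (ascend i))
    where
    ascend : ∀ d → WL (d + s) v w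
    ascend zero = v∼w
    ascend (suc d) = stableRound-+ s stable d v∈V w∈V (ascend d)
    descend : ∀ d {j} → WL (d + j) v w → WL j v w
    descend zero v∼ⱼw = v∼ⱼw
    descend (suc d) {j} v∼ⱼw = descend d (wl-descending (d + j) v∼ⱼw)

  stabilisation : ∃ StableRound
  stabilisation = descending-stabilises (V G) WL wl-isDecEquivalence λ {i} _ _ → wl-descending i

  stableRound : ℕ
  stableRound = proj₁ stabilisation

  -- Opaque, since otherwise type checking evaluates the search for the stable round.
  opaque
    stableColouring : Fin N → ℕ
    stableColouring = classIndex (V G) (wl-isDecEquivalence stableRound)

    stableColouring-≡⇔wl : ∀ {v w} → T (V G v) → T (V G w) →
                           stableColouring v ≡ stableColouring w ⇔ WL stableRound v w
    stableColouring-≡⇔wl = classIndex-≡⇔ (V G) (wl-isDecEquivalence stableRound)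

    stableColouring<N : ∀ {v} → T (V G v) → stableColouring v < N
    stableColouring<N = classIndex<N (V G) (wl-isDecEquivalence stableRound)

  stableColouring-≡⇔ : ∀ v w → T (V G v) → T (V G w) →
                       (stableColouring v ≡ stableColouring w) ⇔ StableEq G v w
  stableColouring-≡⇔ v w v∈V w∈V = mk⇔
    (stableRound⇒StableEq stableRound (proj₂ stabilisation) v∈V w∈V ∘ to (stableColouring-≡⇔wl v∈V w∈V))
    (λ v∼w → from (stableColouring-≡⇔wl v∈V w∈V) (v∼w stableRound))

  stableColouring-refines : ∀ {v w} → T (V G v) → T (V G w) →
                            stableColouring v ≡ stableColouring w → χ G v ≡ χ G w
  stableColouring-refines v∈V w∈V cv≡cw =
    to wl-zero⇔ (to (stableColouring-≡⇔ _ _ v∈V w∈V) cv≡cw 0)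

  stableColouring-equitable : Equitable G stableColouring
  stableColouring-equitable {x} {x′} {z} x∈V x′∈V z∈V cx≡cx′ = begin
    classDegree G c x (c z)   ≡⟨ nbCount≡classDegree x ⟨
    nbCount G s x z           ≡⟨ proj₂ (to (wl-suc⇔ s) x∼x′) z z∈V ⟩
    nbCount G s x′ z          ≡⟨ nbCount≡classDegree x′ ⟩
    classDegree G c x′ (c z)  ∎
    where
    open ≡-Reasoning
    s = stableRound
    c = stableColouring
    x∼x′ : WL (suc s) x x′
    x∼x′ = to (stableColouring-≡⇔ _ _ x∈V x′∈V) cx≡cx′ (suc s)
    nbCount≡classDegree : ∀ y → nbCount G s y z ≡ classDegree G c y (c z)
    nbCount≡classDegree y = trans (nbCount≡count s y z) (count-cong (wlNeighbour? s y z) (colourNeighbour? G c y (c z))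
      ( (λ (w∈V , yw , w∼z) → w∈V , yw , from (stableColouring-≡⇔wl w∈V z∈V) w∼z)
      , (λ (w∈V , yw , cw≡cz) → w∈V , yw , to (stableColouring-≡⇔wl w∈V z∈V) cw≡cz)))

-- Individualisation

module _ {G : ColGraph N} {u : Fin N} {col : ℕ} (fresh : ∀ v → T (V G v) → χ G v ≢ col) where

  indiv-isolates : ∀ {y} → T (V G y) → χ (indiv G u col) y ≡ χ (indiv G u col) u → y ≡ u
  indiv-isolates {y} y∈V eq with y ≟ u | u ≟ u
  ... | yes y≡u | _ = y≡u
  ... | no _ | yes _ = contradiction eq (fresh y y∈V)
  ... | no _ | no u≢u = contradiction refl u≢u

  indiv-refines : ∀ {y y′} → T (V G y) → T (V G y′) →
                  χ (indiv G u col) y ≡ χ (indiv G u col) y′ → χ G y ≡ χ G y′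
  indiv-refines {y} {y′} y∈V y′∈V eq with y ≟ u | y′ ≟ u
  ... | yes refl | yes refl = refl
  ... | yes _ | no _ = contradiction (sym eq) (fresh y′ y′∈V)
  ... | no _ | yes _ = contradiction eq (fresh y y∈V)
  ... | no _ | no _ = eq

module _ {G : ColGraph N} (undirected : Undirected G) {c c′ : Fin N → ℕ}
         (c-equitable : Equitable G c) (c′-equitable : Equitable G c′)
         (refines : ∀ {v w} → T (V G v) → T (V G w) → c′ v ≡ c′ w → c v ≡ c w)
         {u : Fin N} (u∈V : T (V G u)) (isolated : ∀ {y} → T (V G y) → c′ y ≡ c′ u → y ≡ u) where
  open Refinement (V G) (colourEquivalence c) (colourEquivalence c′) refines

  separated : ∀ {y} → T (V G y) → y ≢ u → c′ y ≢ c′ u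
  separated y∈V y≢u = y≢u ∘ isolated y∈V

  adjacency-separated : ∀ {v w} → T (V G v) → T (V G w) → T (adj G u v) → ¬ T (adj G u w) → c′ v ≢ c′ w
  adjacency-separated v∈V w∈V uv ¬uw c′v≡c′w = ¬uw (adj-sym G undirected
    (isolated-adjacency {G = G} {c = c′} c′-equitable u∈V isolated v∈V w∈V c′v≡c′w
                        (adj-sym G undirected uv)))

  nonNeighbour-gain : ∀ {v w} → T (V G v) → T (V G w) → T (adj G u v) → c w ≡ c v →
                      w ≢ u → ¬ T (adj G u w) → colourCount G c + 2 ≤ colourCount G c′
  nonNeighbour-gain {v} {w} v∈V w∈V uv cw≡cv w≢u ¬uw with c u ℕ.≟ c v
  ... | yes cu≡cv = split₃⇒classCount+2≤ u∈V v∈V w∈V cu≡cv (trans cu≡cv (sym cw≡cv))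
                      (≢-sym (separated v∈V (adj⇒≢ G uv ∘ sym))) (≢-sym (separated w∈V w≢u))
                      (adjacency-separated v∈V w∈V uv ¬uw)
  ... | no cu≢cv
    with y , y∈V , wy , cy≡cu ← neighbour-transfer {G = G} {c = c} c-equitable v∈V w∈V u∈V (sym cw≡cv)
                                                    (adj-sym G undirected uv)
    = split₂⇒classCount+2≤ u∈V y∈V v∈V w∈V (sym cy≡cu) (≢-sym (separated y∈V y≢u))
                            (sym cw≡cv) (adjacency-separated v∈V w∈V uv ¬uw) cu≢cv
    where
    y≢u : y ≢ u
    y≢u refl = ¬uw (adj-sym G undirected wy)

  inhomogeneity-gain : ∀ {v u′ v′} → T (V G v) → T (V G u′) → T (V G v′) →
                       c u ≡ c u′ → c v ≡ c v′ → T (adj G u v) → u′ ≢ v′ → ¬ T (adj G u′ v′) →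
                       colourCount G c + 2 ≤ colourCount G c′
  inhomogeneity-gain v∈V u′∈V v′∈V cu≡cu′ cv≡cv′ uv u′≢v′ ¬u′v′ =
    let w , w∈V , cw≡cv′ , w≢u , ¬uw =
          nonNeighbour-transfer {G = G} {c = c} c-equitable u∈V u′∈V v′∈V cu≡cu′
                                (u′≢v′ ∘ sym) ¬u′v′
    in nonNeighbour-gain v∈V w∈V uv (trans cw≡cv′ (sym cv≡cv′)) w≢u ¬uw

-- Flipping a homogeneous colouring

Inhomogeneous : ColGraph N → Set
Inhomogeneous G = ∃[ u ] ∃[ v ] ∃[ u′ ] ∃[ v′ ]
  (T (V G u) × T (V G v) × T (V G u′) × T (V G v′) × χ G u ≡ χ G u′ × χ G v ≡ χ G v′ ×
   T (adj G u v) × u′ ≢ v′ × ¬ T (adj G u′ v′))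

inhomogeneous? : (G : ColGraph N) → Dec (Inhomogeneous G)
inhomogeneous? G = any? λ u → any? λ v → any? λ u′ → any? λ v′ →
  T? (V G u) ×-dec T? (V G v) ×-dec T? (V G u′) ×-dec T? (V G v′) ×-dec
  χ G u ℕ.≟ χ G u′ ×-dec χ G v ℕ.≟ χ G v′ ×-dec
  T? (adj G u v) ×-dec ¬? (u′ ≟ v′) ×-dec ¬? (T? (adj G u′ v′))

reach-∈V : ∀ {G : ColGraph N} {v w} → Reach G v w → T (V G w)
reach-∈V (here w∈V) = w∈V
reach-∈V (step _ w∈V _) = w∈V

edgeless⇒HasIRC : ∀ {G : ColGraph N} {k} → (∀ {x y} → T (V G x) → T (V G y) → ¬ T (adj G x y)) → HasIRC k G
edgeless⇒HasIRC {G = G} edgeless = d3 λ v v∈V → (_==ᶠ v) , (λ w → component w v∈V) , leaf single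
  where
  trivial : ∀ {v w} → Reach G v w → w ≡ v
  trivial (here _) = refl
  trivial (step r w∈V xw) = contradiction xw (edgeless (reach-∈V r) w∈V)
  component : ∀ w {v} → T (V G v) → T (w ==ᶠ v) ⇔ Reach G v w
  component w v∈V = mk⇔ (λ w==v → subst (Reach G _) (sym (toWitness w==v)) (here v∈V)) (fromWitness ∘ trivial)
  single : ∀ {v} → size (induced G (_==ᶠ v)) ≡ 1
  single {v} = trans (countᵇ≡count (_==ᶠ v) (_≟ v) toWitness fromWitness) (count-single (_≟ v) refl id)

homogeneous⇒HasIRC : ∀ {G : ColGraph N} {k} → Undirected G → ¬ Inhomogeneous G → HasIRC k G
homogeneous⇒HasIRC {G = G} undirected homogeneous = d2 f f-sym (edgeless⇒HasIRC {G = flip G f} flip-edgeless)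
  where
  AdjacentColours : ℕ → ℕ → Set
  AdjacentColours a b = ∃[ u ] ∃[ v ] (T (V G u) × T (V G v) × χ G u ≡ a × χ G v ≡ b × T (adj G u v))
  adjacentColours? : ∀ a b → Dec (AdjacentColours a b)
  adjacentColours? a b = any? λ u → any? λ v →
    T? (V G u) ×-dec T? (V G v) ×-dec χ G u ℕ.≟ a ×-dec χ G v ℕ.≟ b ×-dec T? (adj G u v)
  f : ℕ → ℕ → Bool
  f a b = does (adjacentColours? a b)
  swap : ∀ {a b} → AdjacentColours a b → AdjacentColours b a
  swap (u , v , u∈V , v∈V , cu , cv , uv) = v , u , v∈V , u∈V , cv , cu , adj-sym G undirected uv
  f-sym : ∀ a b → f a b ≡ f b a
  f-sym a b = does-⇔ (mk⇔ swap swap) (adjacentColours? a b) (adjacentColours? b a)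
  flipped : ∀ {x y} → T (V G x) → T (V G y) → x ≢ y → (E G x y xor f (χ G x) (χ G y)) ≡ false
  flipped {x} {y} x∈V y∈V x≢y with E G x y in exy
  ... | true = cong not (dec-true (adjacentColours? _ _)
                 (x , y , x∈V , y∈V , refl , refl , from (adj⇔ G) (subst T (sym exy) _ , x≢y)))
  ... | false = dec-false (adjacentColours? _ _) λ (u , v , u∈V , v∈V , cu , cv , uv) →
    homogeneous (u , v , x , y , u∈V , v∈V , x∈V , y∈V , cu , cv , uv , x≢y ,
                 λ xy → subst T exy (proj₁ (to (adj⇔ G) xy)))
  flip-edgeless : ∀ {x y} → T (V G x) → T (V G y) → ¬ T (adj (flip G f) x y)
  flip-edgeless x∈V y∈V xy = let e , x≢y = to (adj⇔ (flip G f)) xy in subst T (flipped x∈V y∈V x≢y) e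

2[1+k]+1+m≡2k+1+[m+2] : ∀ k m → 2 * suc k + 1 + m ≡ 2 * k + 1 + (m + 2)
2[1+k]+1+m≡2k+1+[m+2] =
  solve 2 (λ k m → con 2 :* (con 1 :+ k) :+ con 1 :+ m := con 2 :* k :+ con 1 :+ (m :+ con 2)) refl
  where open +-*-Solver

bounded⇒HasIRC : ∀ {N} k (G : ColGraph N) → Undirected G →
                 size G ≤ 2 * k + 1 + colourCount G (stableColouring G) → HasIRC k G
bounded⇒HasIRC {N} k G undirected bound with inhomogeneous? (recolor G (stableColouring G))
... | no homogeneous =
  d1 (stableColouring G) (stableColouring-≡⇔ G) (homogeneous⇒HasIRC undirected homogeneous)
... | yes (u , v , u′ , v′ , u∈V , v∈V , u′∈V , v′∈V , cu≡cu′ , cv≡cv′ , uv , u′≢v′ , ¬u′v′)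
  = d1 c (stableColouring-≡⇔ G) (individualise k bound)
  where
  c = stableColouring G
  G₁ = recolor G c
  G₂ = indiv G₁ u N
  c′ = stableColouring G₂
  fresh : ∀ v → T (V G v) → c v ≢ N
  fresh v v∈V = <⇒≢ (stableColouring<N G v∈V)
  gain : colourCount G c + 2 ≤ colourCount G c′
  gain = inhomogeneity-gain {G = G} undirected {c = c} {c′ = c′}
           (stableColouring-equitable G) (stableColouring-equitable G₂)
           (λ v∈V w∈V → indiv-refines {G = G₁} fresh v∈V w∈V ∘ stableColouring-refines G₂ v∈V w∈V)
           u∈V (λ y∈V → indiv-isolates {G = G₁} fresh y∈V ∘ stableColouring-refines G₂ y∈V u∈V)
           v∈V u′∈V v′∈V cu≡cu′ cv≡cv′ uv u′≢v′ ¬u′v′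
  individualise : ∀ k → size G ≤ 2 * k + 1 + colourCount G c → HasIRC k G₁
  individualise zero bound = contradiction (≤-trans gain (≤-trans (colourCount≤size G c′) bound))
                                           (1+n≰n ∘ subst (_≤ suc (colourCount G c)) (+-comm (colourCount G c) 2))
  individualise (suc k) bound = d4 u N u∈V fresh (bounded⇒HasIRC k G₂ undirected (begin
    size G                             ≤⟨ bound ⟩
    2 * suc k + 1 + colourCount G c    ≡⟨ 2[1+k]+1+m≡2k+1+[m+2] k (colourCount G c) ⟩
    2 * k + 1 + (colourCount G c + 2)  ≤⟨ +-monoʳ-≤ (2 * k + 1) gain ⟩
    2 * k + 1 + colourCount G c′       ∎))
    where open ≤-Reasoning

halve : ∀ n → 1 ≤ n → ∃[ k ] (2 * k + 1 ≤ n × n ≤ 2 * k + 1 + 1)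
halve (suc zero) _ = 0 , ≤-refl , s≤s z≤n
halve (suc (suc zero)) _ = 0 , s≤s z≤n , ≤-refl
halve (suc (suc (suc n))) _ with k , lower , upper ← halve (suc n) (s≤s z≤n) =
  suc k , subst (λ m → m + 1 ≤ 3 + n) (sym (*-suc 2 k)) (s≤s (s≤s lower))
        , subst (λ m → 3 + n ≤ m + 1 + 1) (sym (*-suc 2 k)) (s≤s (s≤s upper))

corollary18 : {N : ℕ} (G : ColGraph N) →
              (∀ v w → E G v w ≡ E G w v) →
              1 ≤ size G →
              ∃[ k ] (2 * k + 1 ≤ size G × HasIRC k G)
corollary18 G undirected nonempty with k , lower , upper ← halve (size G) nonempty =
  k , lower , bounded⇒HasIRC k G undirected
                (≤-trans upper (+-monoʳ-≤ (2 * k + 1) (colourCount-pos G (stableColouring G) nonempty)))
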